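{- Let $n\ge2$ and $m\ge3$ be integers. Then (1) $\mathrm{L}_n$ is not a butterfly minor of $\mathrm{CC}_m$, and (2) $\mathrm{CC}_m$ is not a butterfly minor of $\mathrm{L}_n$.
   Context: $\mathrm{L}_n$: disjoint directed paths $p_1\cdots p_n$ and $q_1\cdots q_n$ together with edges $(p_i,q_{n+1-i})$ and $(q_{n+1-i},p_i)$ for all $i\in[n]$. $\mathrm{CC}_m$: the undirected path $v_1\cdots v_m$ with each edge replaced by a directed cycle of length 2. An edge $(u,v)$ is butterfly contractible if it is the only edge with tail $u$ or the only edge with head $v$; butterfly contraction identifies $u,v$, redirecting incident edges and removing multiple edges. A butterfly minor is (isomorphic to) a digraph obtained by vertex deletions, edge deletions and butterfly contractions. -}

module Defs where

open import Level using (0ℓ)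
open import Data.Nat using (ℕ; suc; _+_; _<_; _≤_)
open import Data.Fin using (Fin; toℕ; punchIn; punchOut; _≟_)
open import Data.Product using (Σ; _×_; ∃; ∃-syntax)
open import Data.Sum using (_⊎_)
open import Relation.Nullary using (¬_; yes; no)
open import Relation.Binary.PropositionalEquality using (_≡_; _≢_)
open import Function.Bundles using (_↔_; Inverse)

-- A digraph on the vertex set Fin size; adj a b means (a,b) is an edge.
-- Simple digraphs: at most one edge (a,b) per ordered pair.
record Digraph : Set₁ where
  constructor mkDigraph
  field
    size : ℕ
    adj  : Fin size → Fin size → Set
open Digraph public

record _≅_ (G H : Digraph) : Set where
  field
    bij  : Fin (size G) ↔ Fin (size H)
    pres : ∀ a b → adj G a b → adj H (Inverse.to bij a) (Inverse.to bij b)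
    refl' : ∀ a b → adj H (Inverse.to bij a) (Inverse.to bij b) → adj G a b

deleteVertex : (n : ℕ) → (Fin (suc n) → Fin (suc n) → Set) → Fin (suc n) → Digraph
deleteVertex n E v = mkDigraph n (λ a b → E (punchIn v a) (punchIn v b))

deleteEdge : (G : Digraph) → Fin (size G) → Fin (size G) → Digraph
deleteEdge G u v = mkDigraph (size G) (λ a b → adj G a b × ¬ (a ≡ u × b ≡ v))

-- The quotient map identifying v with u (v is removed, u survives).
merge : {n : ℕ} (u v : Fin (suc n)) → v ≢ u → Fin (suc n) → Fin n
merge u v v≢u i with i ≟ v
... | yes _  = punchOut v≢u
... | no i≢v = punchOut (λ v≡i → i≢v (Relation.Binary.PropositionalEquality.sym v≡i))

-- Result of contracting the edge (u,v): identify u and v, redirect incident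
-- edges, remove multiple edges (automatic, adjacency is a relation) and
-- the loops arising from (u,v) (and (v,u)).
contract : (n : ℕ) → (Fin (suc n) → Fin (suc n) → Set) →
           (u v : Fin (suc n)) → v ≢ u → Digraph
contract n E u v v≢u =
  mkDigraph n (λ a b → ¬ (a ≡ b) ×
    (∃[ x ] ∃[ y ] (merge u v v≢u x ≡ a × merge u v v≢u y ≡ b × E x y)))

ButterflyContractible : (G : Digraph) → Fin (size G) → Fin (size G) → Set
ButterflyContractible G u v =
  adj G u v × ((∀ w → adj G u w → w ≡ v) ⊎ (∀ w → adj G w v → w ≡ u))

data Step : Digraph → Digraph → Set₁ where
  vdel : ∀ n E (v : Fin (suc n)) → Step (mkDigraph (suc n) E) (deleteVertex n E v)
  edel : ∀ G (u v : Fin (size G)) → Step G (deleteEdge G u v)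
  bcon : ∀ n E (u v : Fin (suc n)) (v≢u : v ≢ u) →
         ButterflyContractible (mkDigraph (suc n) E) u v →
         Step (mkDigraph (suc n) E) (contract n E u v v≢u)

data _⇝_ : Digraph → Digraph → Set₁ where
  done : ∀ {G} → G ⇝ G
  step : ∀ {G H K} → Step G H → H ⇝ K → G ⇝ K

ButterflyMinor : Digraph → Digraph → Set₁
ButterflyMinor H G = Σ Digraph (λ K → (G ⇝ K) × (H ≅ K))

-- L_n on Fin (n + n): p_{k+1} is vertex k, q_{k+1} is vertex n + k (0 ≤ k < n).
-- Path edges p_i → p_{i+1}, q_i → q_{i+1}; cross edges p_i ↔ q_{n+1-i},
-- i.e. vertices x,y with x + y + 1 = 2n.
L : ℕ → Digraph
L n = mkDigraph (n + n) (λ a b →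
  (toℕ b ≡ suc (toℕ a) × ¬ (suc (toℕ a) ≡ n)) ⊎ (suc (toℕ a + toℕ b) ≡ n + n))

-- CC_m on Fin m: v_{k+1} is vertex k; edges both ways between consecutive vertices.
CC : ℕ → Digraph
CC m = mkDigraph m (λ a b → (toℕ b ≡ suc (toℕ a)) ⊎ (toℕ a ≡ suc (toℕ b)))

-- Both parts follow from properties of digraphs that are inherited by butterfly minors.
--
-- (1) The underlying undirected graph being a forest. It is witnessed by a ranking of the
-- vertices in which every vertex has at most one neighbour of smaller rank; deletions keep
-- it, and so does contracting an edge, the merged vertex taking the smaller of the two ranks.
-- CC m has such a ranking, but L n with n ≥ 2 contains the square p₁ p₂ q_{n-1} q_n.
--
-- (2) In every subdigraph, any two strongly connected vertices lie on a common cycle.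
-- Deletions keep this, and so does a butterfly contraction of (u, v): when v is the only
-- out-neighbour of u (or u the only in-neighbour of v), a cycle in the preimage of a
-- subdigraph passes through u (or v) only along (u, v), so deleting that vertex gives a
-- cycle of the subdigraph. L n embeds in an infinite ladder, which has the property,
-- whereas in CC 3, a subdigraph of every CC m with m ≥ 3, the strongly connected
-- vertices v₁ and v₃ lie on no common cycle.

module Submission where

open import Defs
open import Level using (0ℓ)
open import Data.Nat using (ℕ; zero; suc; _+_; _≤_; _<_; _≤?_; _<?_; z≤n; s≤s; z<s; s≤s⁻¹)
open import Data.Nat.Properties
  using ( <-cmp; <-irrefl; <-trans; ≤-<-trans; <-≤-trans; ≤-refl; ≤-antisym; <⇒≤; <⇒≢; <⇒≱; ≤⇒≯; ≰⇒>; ≮⇒≥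
        ; n<1+n; 1+n≰n; n≮n; m≤m+n; m≤n+m; m<m+n; m≤n⇒m<n∨m≡n; m≤n⇒∃[o]m+o≡n; m+[n∸m]≡n
        ; +-identityʳ; +-suc; +-comm; +-mono-≤; +-monoʳ-<; +-cancelʳ-≡; +-cancelˡ-≡; suc-injective )
open import Data.Fin as Fin using (Fin; toℕ; fromℕ; inject₁; inject≤; punchIn)
open import Data.Fin.Properties
  using ( punchIn-injective; punchInᵢ≢i; punchIn-punchOut; toℕ<n; toℕ-injective
        ; toℕ-fromℕ; toℕ-inject₁; toℕ-inject≤; inject≤-injective )
  renaming (_≟_ to _≟ᶠ_)
open import Data.List using (List; []; _∷_; _++_; map; filter)
open import Data.List.Properties using (filter-all)
open import Data.List.Relation.Unary.Any using (here; there)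
open import Data.List.Relation.Unary.All as All using (All; []; _∷_)
open import Data.List.Relation.Unary.All.Properties using (¬Any⇒All¬; All¬⇒¬Any)
import Data.List.Relation.Unary.All.Properties as Allₚ
open import Data.List.Relation.Unary.Unique.Propositional using (Unique; []; _∷_)
import Data.List.Relation.Unary.Unique.Propositional.Properties as Unique
open import Data.List.Membership.Propositional using (_∈_; _∉_)
open import Data.List.Relation.Binary.Disjoint.Propositional using (Disjoint)
open import Data.List.Extrema.Nat using (argmin; argmax; argmin-all; argmax-all; f[argmin]≤f[xs]; f[xs]≤f[argmax])
open import Data.List.Membership.Propositional.Properties
  using (∈-map⁺; ∈-map⁻; ∈-filter⁺; ∈-++⁺ˡ; ∈-++⁺ʳ)
open import Data.Bool using (Bool; true; false; not)
open import Data.Bool.Properties using (not-involutive; not-¬)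
open import Data.Product as Product using (∃; ∃-syntax; _×_; _,_; proj₁; proj₂)
open import Data.Sum using (_⊎_; inj₁; inj₂)
open import Data.Empty using (⊥)
open import Function.Base using (_∘_)
open import Function.Definitions using (Injective)
open import Function.Bundles using (Inverse; Injection)
open import Function.Properties.Inverse using (Inverse⇒Injection)
open import Relation.Nullary using (¬_; Dec; yes; no; ¬?; contradiction)
open import Relation.Binary using (Rel; _⇒_; _=[_]⇒_; DecidableEquality; tri<; tri≈; tri>)
open import Relation.Binary.Construct.Closure.ReflexiveTransitive using (Star; ε; _◅_; _◅◅_; gmap; kleisliStar)
open import Relation.Binary.Construct.Closure.Symmetric as Sym using (SymClosure; fwd; bwd)
open import Relation.Binary.PropositionalEquality

private variable
  X Y : Set

Path : Rel X 0ℓ → X → List X → X → Set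
Path E a []       b = E a b
Path E a (c ∷ cs) b = E a c × Path E c cs b

ClosedWalk : Rel X 0ℓ → List X → Set
ClosedWalk E []       = ⊥
ClosedWalk E (a ∷ as) = Path E a as a

Cycle : Rel X 0ℓ → List X → Set
Cycle E D = Unique D × ClosedWalk E D

StrongPairsOnCycles : Rel X 0ℓ → Set
StrongPairsOnCycles F = ∀ {x y} → x ≢ y → Star F x y → Star F y x →
  ∃[ D ] Cycle F D × x ∈ D × y ∈ D

Hereditary : (Rel X 0ℓ → Set) → Rel X 0ℓ → Set₁
Hereditary {X} P E = (F : Rel X 0ℓ) → F ⇒ E → P F

record ForestRanking (E : Rel X 0ℓ) : Set where
  field
    rank : X → ℕ
    rank-injective : Injective _≡_ _≡_ rank
    lower-neighbour-unique : ∀ {x y z} → SymClosure E x y → SymClosure E x z →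
      rank y < rank x → rank z < rank x → y ≡ z

-- Pulling back along injective homomorphisms

module _ {g : X → Y} (g-injective : Injective _≡_ _≡_ g) where

  Image : Rel X 0ℓ → Rel Y 0ℓ
  Image F a′ b′ = ∃[ a ] ∃[ b ] g a ≡ a′ × g b ≡ b′ × F a b

  private
    image-edge : ∀ {F : Rel X 0ℓ} → F =[ g ]⇒ Image F
    image-edge f = _ , _ , refl , refl , f

    path-preimage : ∀ {F a b} cs → Path (Image F) (g a) cs (g b) →
      ∃[ ds ] map g ds ≡ cs × Path F a ds b
    path-preimage [] (_ , _ , ga≡ , gb≡ , f)
      with refl ← g-injective ga≡ | refl ← g-injective gb≡ = [] , refl , f
    path-preimage (c ∷ cs) ((_ , c₀ , ga≡ , refl , f) , p)
      with refl ← g-injective ga≡ | ds , refl , q ← path-preimage cs p =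
      c₀ ∷ ds , refl , f , q

    source-preimage : ∀ {F a′ b′} cs → Path (Image F) a′ cs b′ → ∃[ a ] g a ≡ a′
    source-preimage []      (a , _ , ga≡ , _)       = a , ga≡
    source-preimage (_ ∷ _) ((a , _ , ga≡ , _) , _) = a , ga≡

    closedWalk-preimage : ∀ {F} D → ClosedWalk (Image F) D →
      ∃[ C ] map g C ≡ D × ClosedWalk F C
    closedWalk-preimage (_ ∷ bs) w
      with a , refl ← source-preimage bs w
      with ds , refl , q ← path-preimage bs w =
      a ∷ ds , refl , q

    ∈-map-injective : ∀ {x xs} → g x ∈ map g xs → x ∈ xs
    ∈-map-injective gx∈ with _ , x′∈ , gx≡ ← ∈-map⁻ g gx∈
      rewrite g-injective gx≡ = x′∈

  strongPairsOnCycles-preimage : ∀ {F} → StrongPairsOnCycles (Image F) →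
    StrongPairsOnCycles F
  strongPairsOnCycles-preimage spc x≢y xy yx
    with D , (!D , w) , x∈ , y∈ ← spc (x≢y ∘ g-injective) (gmap g image-edge xy) (gmap g image-edge yx)
    with C , refl , w′ ← closedWalk-preimage D w =
    C , (Unique.map⁻ !D , w′) , ∈-map-injective x∈ , ∈-map-injective y∈

  hereditary-preimage : ∀ {E E′} → E =[ g ]⇒ E′ →
    Hereditary StrongPairsOnCycles E′ → Hereditary StrongPairsOnCycles E
  hereditary-preimage hom spc F F⇒E =
    strongPairsOnCycles-preimage (spc (Image F) λ { (_ , _ , refl , refl , f) → hom (F⇒E f) })

  forestRanking-preimage : ∀ {E E′} → E =[ g ]⇒ E′ → ForestRanking E′ → ForestRanking E
  forestRanking-preimage hom fr = record
    { rank = rank ∘ g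
    ; rank-injective = g-injective ∘ rank-injective
    ; lower-neighbour-unique = λ xy xz y< z< →
        g-injective (lower-neighbour-unique (Sym.gmap g hom xy) (Sym.gmap g hom xz) y< z<)
    }
    where open ForestRanking fr

unique-map-on : ∀ {P : X → Set} {h : X → Y} →
  (∀ {a b} → P a → P b → h a ≡ h b → a ≡ b) →
  ∀ {xs} → All P xs → Unique xs → Unique (map h xs)
unique-map-on inj []         []          = []
unique-map-on inj (pa ∷ pxs) (a≢ ∷ !xs) =
  Allₚ.map⁺ (All.zipWith (λ (a≢b , pb) → a≢b ∘ inj pa pb) (a≢ , pxs)) ∷ unique-map-on inj pxs !xs

-- Removing a vertex d from a cycle of R and mapping it along h gives a cycle of S,
-- provided h turns R-edges avoiding d, and R-paths of length two through d, into S-edges.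
module Bypass {R : Rel X 0ℓ} {S : Rel Y 0ℓ} (_≟_ : DecidableEquality X) (h : X → Y) (d : X)
  (avoid   : ∀ {a b} → R a b → a ≢ d → b ≢ d → S (h a) (h b))
  (through : ∀ {a b} → R a d → R d b → S (h a) (h b))
  where

  delete : List X → List X
  delete = filter (λ z → ¬? (z ≟ d))

  private
    ∉⇒avoiding : ∀ {xs} → d ∉ xs → All (_≢ d) xs
    ∉⇒avoiding d∉ = All.map (λ d≢z → d≢z ∘ sym) (¬Any⇒All¬ _ d∉)

    path-avoiding : ∀ {a b} cs → a ≢ d → All (_≢ d) cs → b ≢ d →
      Path R a cs b → Path S (h a) (map h cs) (h b)
    path-avoiding []       a≢d []           b≢d r       = avoid r a≢d b≢d
    path-avoiding (c ∷ cs) a≢d (c≢d ∷ cs≢d) b≢d (r , p) =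
      avoid r a≢d c≢d , path-avoiding cs c≢d cs≢d b≢d p

    path-into : ∀ {a b} cs → a ≢ d → All (_≢ d) cs →
      Path R a cs d → R d b → Path S (h a) (map h cs) (h b)
    path-into []       a≢d []           r       r′ = through r r′
    path-into (c ∷ cs) a≢d (c≢d ∷ cs≢d) (r , p) r′ = avoid r a≢d c≢d , path-into cs c≢d cs≢d p r′

    path-bypass : ∀ {a b} cs → a ≢ d → b ≢ d → Unique cs →
      Path R a cs b → Path S (h a) (map h (delete cs)) (h b)
    path-bypass []       a≢d b≢d _ r = avoid r a≢d b≢d
    path-bypass (c ∷ cs) a≢d b≢d (c≢cs ∷ !cs) (r , p) with c ≟ d
    ... | no c≢d = avoid r a≢d c≢d , path-bypass cs c≢d b≢d !cs p
    path-bypass (c ∷ []) a≢d b≢d _ (r , p) | yes refl = through r p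
    path-bypass (c ∷ e ∷ es) a≢d b≢d (c≢cs ∷ _) (r , r′ , p) | yes refl
      with e≢d ∷ es≢d ← ∉⇒avoiding (All¬⇒¬Any c≢cs)
      rewrite filter-all (λ z → ¬? (z ≟ d)) (e≢d ∷ es≢d) =
      through r r′ , path-avoiding es e≢d es≢d b≢d p

    closedWalk-bypass : ¬ R d d → ∀ D → Unique D → ClosedWalk R D →
      ClosedWalk S (map h (delete D))
    closedWalk-bypass ¬Rdd (a ∷ as) (a≢as ∷ !as) w with a ≟ d
    ... | no a≢d = path-bypass as a≢d a≢d !as w
    closedWalk-bypass ¬Rdd (a ∷ []) _ w | yes refl = ¬Rdd w
    closedWalk-bypass ¬Rdd (a ∷ c ∷ cs) (a≢as ∷ _) (r , p) | yes refl
      with c≢d ∷ cs≢d ← ∉⇒avoiding (All¬⇒¬Any a≢as)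
      rewrite filter-all (λ z → ¬? (z ≟ d)) (c≢d ∷ cs≢d) =
      path-into cs c≢d cs≢d p r

  cycle-bypass : (∀ {a b} → a ≢ d → b ≢ d → h a ≡ h b → a ≡ b) → ¬ R d d →
    ∀ {D} → Cycle R D → Cycle S (map h (delete D))
  cycle-bypass h-injective ¬Rdd {D} (!D , w) =
    unique-map-on h-injective (Allₚ.all-filter _ D) (Unique.filter⁺ _ !D) ,
    closedWalk-bypass ¬Rdd D !D w

  ∈-bypass : ∀ {z D} → z ∈ D → z ≢ d → h z ∈ map h (delete D)
  ∈-bypass z∈ z≢d = ∈-map⁺ h (∈-filter⁺ _ z∈ z≢d)

module _ {R : Rel X 0ℓ} {F : Rel Y 0ℓ} (_≟_ : DecidableEquality X)
  (μ : X → Y) (σ : Y → X) (μ∘σ : ∀ a → μ (σ a) ≡ a)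
  (d : X) (σ-avoids : ∀ a → σ a ≢ d)
  (lift : F =[ σ ]⇒ Star R)
  (avoid : ∀ {a b} → R a b → a ≢ d → b ≢ d → F (μ a) (μ b))
  (through : ∀ {a b} → R a d → R d b → F (μ a) (μ b))
  (¬Rdd : ¬ R d d)
  (μ-injective : ∀ {a b} → a ≢ d → b ≢ d → μ a ≡ μ b → a ≡ b)
  where

  private
    σ-injective : Injective _≡_ _≡_ σ
    σ-injective {a} {b} σa≡σb = trans (sym (μ∘σ a)) (trans (cong μ σa≡σb) (μ∘σ b))

  strongPairsOnCycles-descent : StrongPairsOnCycles R → StrongPairsOnCycles F
  strongPairsOnCycles-descent spc {x} {y} x≢y xy yx
    with D , cycle , x∈ , y∈ ← spc (x≢y ∘ σ-injective) (kleisliStar σ lift xy) (kleisliStar σ lift yx) =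
    map μ (delete D) , cycle-bypass μ-injective ¬Rdd cycle ,
    subst (_∈ _) (μ∘σ x) (∈-bypass x∈ (σ-avoids x)) ,
    subst (_∈ _) (μ∘σ y) (∈-bypass y∈ (σ-avoids y))
    where
    open Bypass {R = R} {S = F} _≟_ μ d avoid through

-- Contracting an edge

module Merge {n : ℕ} (u v : Fin (suc n)) (v≢u : v ≢ u) where

  μ : Fin (suc n) → Fin n
  μ = merge u v v≢u

  Merged : Fin (suc n) → Set
  Merged x = x ≡ u ⊎ x ≡ v

  punchIn-μ : ∀ {x} → x ≢ v → punchIn v (μ x) ≡ x
  punchIn-μ {x} x≢v with x ≟ᶠ v
  ... | yes x≡v = contradiction x≡v x≢v
  ... | no _    = punchIn-punchOut _

  punchIn-μv : punchIn v (μ v) ≡ u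
  punchIn-μv with v ≟ᶠ v
  ... | yes _   = punchIn-punchOut v≢u
  ... | no v≢v = contradiction refl v≢v

  μ-punchIn : ∀ a → μ (punchIn v a) ≡ a
  μ-punchIn a = punchIn-injective v _ _ (punchIn-μ (punchInᵢ≢i v a))

  μu≡μv : μ u ≡ μ v
  μu≡μv = punchIn-injective v _ _ (trans (punchIn-μ (v≢u ∘ sym)) (sym punchIn-μv))

  Merged⇒μ≡μu : ∀ {x} → Merged x → μ x ≡ μ u
  Merged⇒μ≡μu (inj₁ refl) = refl
  Merged⇒μ≡μu (inj₂ refl) = sym μu≡μv

  μ-fibre : ∀ {a b} → μ a ≡ μ b → a ≡ b ⊎ (Merged a × Merged b)
  μ-fibre {a} {b} μa≡μb = fibre (a ≟ᶠ v) (b ≟ᶠ v)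
    where
    open ≡-Reasoning
    fibre : Dec (a ≡ v) → Dec (b ≡ v) → a ≡ b ⊎ (Merged a × Merged b)
    fibre (yes a≡v) (yes b≡v) = inj₁ (trans a≡v (sym b≡v))
    fibre (yes a≡v) (no b≢v)  = inj₂ (inj₂ a≡v , inj₁ (begin
      b                 ≡⟨ punchIn-μ b≢v ⟨
      punchIn v (μ b)   ≡⟨ cong (punchIn v) μa≡μb ⟨
      punchIn v (μ a)   ≡⟨ cong (punchIn v ∘ μ) a≡v ⟩
      punchIn v (μ v)   ≡⟨ punchIn-μv ⟩
      u                 ∎))
    fibre (no a≢v)  (yes b≡v) = inj₂ (inj₁ (begin
      a                 ≡⟨ punchIn-μ a≢v ⟨
      punchIn v (μ a)   ≡⟨ cong (punchIn v) μa≡μb ⟩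
      punchIn v (μ b)   ≡⟨ cong (punchIn v ∘ μ) b≡v ⟩
      punchIn v (μ v)   ≡⟨ punchIn-μv ⟩
      u                 ∎) , inj₂ b≡v)
    fibre (no a≢v)  (no b≢v)  = inj₁ (begin
      a                 ≡⟨ punchIn-μ a≢v ⟨
      punchIn v (μ a)   ≡⟨ cong (punchIn v) μa≡μb ⟩
      punchIn v (μ b)   ≡⟨ punchIn-μ b≢v ⟩
      b                 ∎)

  μ≡μu⇒Merged : ∀ {x} → μ x ≡ μ u → Merged x
  μ≡μu⇒Merged μx≡μu with μ-fibre μx≡μu
  ... | inj₁ x≡u       = inj₁ x≡u
  ... | inj₂ (merged , _) = merged

  Merged-unique-off : ∀ {w a b} → Merged w → Merged a → Merged b → a ≢ w → b ≢ w → a ≡ b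
  Merged-unique-off _           (inj₁ refl) (inj₁ refl) _   _   = refl
  Merged-unique-off _           (inj₂ refl) (inj₂ refl) _   _   = refl
  Merged-unique-off (inj₁ refl) (inj₁ refl) (inj₂ refl) a≢w _   = contradiction refl a≢w
  Merged-unique-off (inj₂ refl) (inj₁ refl) (inj₂ refl) _   b≢w = contradiction refl b≢w
  Merged-unique-off (inj₁ refl) (inj₂ refl) (inj₁ refl) _   b≢w = contradiction refl b≢w
  Merged-unique-off (inj₂ refl) (inj₂ refl) (inj₁ refl) a≢w _   = contradiction refl a≢w

  μ-injective-off : ∀ {w a b} → Merged w → a ≢ w → b ≢ w → μ a ≡ μ b → a ≡ b
  μ-injective-off w-merged a≢w b≢w μa≡μb with μ-fibre μa≡μb
  ... | inj₁ a≡b = a≡b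
  ... | inj₂ (a-merged , b-merged) = Merged-unique-off w-merged a-merged b-merged a≢w b≢w

  representative : Fin (suc n) → Fin n → Fin (suc n)
  representative w a with a ≟ᶠ μ u
  ... | yes _ = w
  ... | no _  = punchIn v a

  module _ {w : Fin (suc n)} (w-merged : Merged w) where

    μ-representative : ∀ a → μ (representative w a) ≡ a
    μ-representative a with a ≟ᶠ μ u
    ... | yes a≡μu = trans (Merged⇒μ≡μu w-merged) (sym a≡μu)
    ... | no _     = μ-punchIn a

    representative-μ : ∀ {x} → μ x ≢ μ u → representative w (μ x) ≡ x
    representative-μ {x} μx≢μu with μ x ≟ᶠ μ u
    ... | yes μx≡μu = contradiction μx≡μu μx≢μu
    ... | no _      = punchIn-μ (λ x≡v → μx≢μu (trans (cong μ x≡v) (sym μu≡μv)))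

    representative-μu : ∀ {x} → μ x ≡ μ u → representative w (μ x) ≡ w
    representative-μu {x} μx≡μu with μ x ≟ᶠ μ u
    ... | yes _     = refl
    ... | no μx≢μu  = contradiction μx≡μu μx≢μu

    representative-μ-off : ∀ {w′ x} → Merged w′ → w ≢ w′ → x ≢ w′ → representative w (μ x) ≡ x
    representative-μ-off {x = x} w′-merged w≢w′ x≢w′ = fix (μ x ≟ᶠ μ u)
      where
      fix : Dec (μ x ≡ μ u) → representative w (μ x) ≡ x
      fix (yes μx≡μu) = trans (representative-μu {x} μx≡μu)
        (Merged-unique-off w′-merged w-merged (μ≡μu⇒Merged μx≡μu) w≢w′ x≢w′)
      fix (no μx≢μu)  = representative-μ {x} μx≢μu

    representative-avoids : ∀ {w′} → Merged w′ → w ≢ w′ → ∀ a → representative w a ≢ w′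
    representative-avoids {w′} w′-merged w≢w′ a with a ≟ᶠ μ u
    ... | yes _    = w≢w′
    ... | no a≢μu  = λ r≡w′ → a≢μu (begin
      a                    ≡⟨ μ-punchIn a ⟨
      μ (punchIn v a)      ≡⟨ cong μ r≡w′ ⟩
      μ w′                 ≡⟨ Merged⇒μ≡μu w′-merged ⟩
      μ u                  ∎)
      where open ≡-Reasoning

module Contraction {n : ℕ} (E : Rel (Fin (suc n)) 0ℓ) (u v : Fin (suc n)) (v≢u : v ≢ u) where
  open Merge u v v≢u

  E/ : Rel (Fin n) 0ℓ
  E/ = adj (contract n E u v v≢u)

  module _ (euv : E u v) (F : Rel (Fin n) 0ℓ) (F⇒E/ : F ⇒ E/) where

    Lift : Rel (Fin (suc n)) 0ℓ
    Lift x y = E x y × (F (μ x) (μ y) ⊎ (x ≡ u × y ≡ v))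

    private
      u-merged : Merged u
      u-merged = inj₁ refl

      v-merged : Merged v
      v-merged = inj₂ refl

      ¬Lift-loop : ∀ {d} → ¬ Lift d d
      ¬Lift-loop (_ , inj₁ f)           = proj₁ (F⇒E/ f) refl
      ¬Lift-loop (_ , inj₂ (d≡u , d≡v)) = v≢u (trans (sym d≡v) d≡u)

    strongPairsOnCycles-contract-out : (∀ w → E u w → w ≡ v) →
      StrongPairsOnCycles Lift → StrongPairsOnCycles F
    strongPairsOnCycles-contract-out only-out =
      strongPairsOnCycles-descent _≟ᶠ_ μ (representative v) (μ-representative v-merged)
        u (representative-avoids v-merged u-merged v≢u) lift avoid through ¬Lift-loop
        (μ-injective-off u-merged)
      where
      fixes : ∀ {x} → x ≢ u → representative v (μ x) ≡ x
      fixes = representative-μ-off v-merged u-merged v≢u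

      source≢u : ∀ {x y} → E x y → μ x ≢ μ y → x ≢ u
      source≢u exy μx≢μy refl = μx≢μy (trans μu≡μv (cong μ (sym (only-out _ exy))))

      lift : F =[ representative v ]⇒ Star Lift
      lift f with F⇒E/ f
      ... | μx≢μy , x , y , refl , refl , exy with y ≟ᶠ u
      ...   | no y≢u rewrite fixes (source≢u exy μx≢μy) | fixes y≢u = (exy , inj₁ f) ◅ ε
      ...   | yes refl rewrite fixes (source≢u exy μx≢μy) | representative-μu v-merged {u} refl =
        (exy , inj₁ f) ◅ (euv , inj₂ (refl , refl)) ◅ ε

      avoid : ∀ {a b} → Lift a b → a ≢ u → b ≢ u → F (μ a) (μ b)
      avoid (_ , inj₁ f)            _   _ = f
      avoid (_ , inj₂ (a≡u , _))    a≢u _ = contradiction a≡u a≢u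

      through : ∀ {a b} → Lift a u → Lift u b → F (μ a) (μ b)
      through (_ , inj₁ f)         (eub , _) =
        subst (F _) (trans μu≡μv (cong μ (sym (only-out _ eub)))) f
      through (_ , inj₂ (_ , u≡v)) _        = contradiction (sym u≡v) v≢u

    strongPairsOnCycles-contract-in : (∀ w → E w v → w ≡ u) →
      StrongPairsOnCycles Lift → StrongPairsOnCycles F
    strongPairsOnCycles-contract-in only-in =
      strongPairsOnCycles-descent _≟ᶠ_ μ (representative u) (μ-representative u-merged)
        v (representative-avoids u-merged v-merged (v≢u ∘ sym)) lift avoid through ¬Lift-loop
        (μ-injective-off v-merged)
      where
      fixes : ∀ {x} → x ≢ v → representative u (μ x) ≡ x
      fixes = representative-μ-off u-merged v-merged (v≢u ∘ sym)

      target≢v : ∀ {x y} → E x y → μ x ≢ μ y → y ≢ v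
      target≢v exy μx≢μy refl = μx≢μy (trans (cong μ (only-in _ exy)) μu≡μv)

      lift : F =[ representative u ]⇒ Star Lift
      lift f with F⇒E/ f
      ... | μx≢μy , x , y , refl , refl , exy
        rewrite fixes (target≢v exy μx≢μy) = from-source (x ≟ᶠ v)
        where
        from-source : Dec (x ≡ v) → Star Lift (representative u (μ x)) y
        from-source (no x≢v)  rewrite fixes x≢v = (exy , inj₁ f) ◅ ε
        from-source (yes refl) rewrite representative-μu u-merged {v} (sym μu≡μv) =
          (euv , inj₂ (refl , refl)) ◅ (exy , inj₁ f) ◅ ε

      avoid : ∀ {a b} → Lift a b → a ≢ v → b ≢ v → F (μ a) (μ b)
      avoid (_ , inj₁ f)         _ _   = f
      avoid (_ , inj₂ (_ , b≡v)) _ b≢v = contradiction b≡v b≢v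

      through : ∀ {a b} → Lift a v → Lift v b → F (μ a) (μ b)
      through (eav , _) (_ , inj₁ f)         =
        subst (λ z → F z _) (trans (sym μu≡μv) (cong μ (sym (only-in _ eav)))) f
      through _         (_ , inj₂ (v≡u , _)) = contradiction v≡u v≢u

  hereditary-butterfly-contract : ButterflyContractible (mkDigraph (suc n) E) u v →
    Hereditary StrongPairsOnCycles E → Hereditary StrongPairsOnCycles E/
  hereditary-butterfly-contract (euv , inj₁ only-out) spc F F⇒E/ =
    strongPairsOnCycles-contract-out euv F F⇒E/ only-out (spc _ proj₁)
  hereditary-butterfly-contract (euv , inj₂ only-in) spc F F⇒E/ =
    strongPairsOnCycles-contract-in euv F F⇒E/ only-in (spc _ proj₁)

  module _ (euv : E u v) (fr : ForestRanking E) where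
    open ForestRanking fr

    private
      unpack : ∀ {a b} → SymClosure E/ a b →
        a ≢ b × ∃[ x ] ∃[ y ] μ x ≡ a × μ y ≡ b × SymClosure E x y
      unpack (fwd (a≢b , x , y , μx≡a , μy≡b , exy)) = a≢b , x , y , μx≡a , μy≡b , fwd exy
      unpack (bwd (b≢a , y , x , μy≡b , μx≡a , eyx)) = b≢a ∘ sym , x , y , μx≡a , μy≡b , bwd eyx

    -- s and t are the ends of the contracted edge, s the one of smaller rank;
    -- the merged vertex inherits the rank of s.
    module Ordered (s t : Fin (suc n)) (s-merged : Merged s) (t-merged : Merged t)
                   (s<t : rank s < rank t) (st : SymClosure E s t) where

      σ : Fin n → Fin (suc n)
      σ = representative s

      merged-cases : ∀ {x} → Merged x → x ≡ s ⊎ x ≡ t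
      merged-cases {x} x-merged with x ≟ᶠ s
      ... | yes x≡s = inj₁ x≡s
      ... | no x≢s  = inj₂ (Merged-unique-off s-merged x-merged t-merged x≢s
                                               (λ t≡s → <-irrefl (cong rank (sym t≡s)) s<t))

      t-below-outside : ∀ {y} → SymClosure E t y → μ y ≢ μ u → rank t < rank y
      t-below-outside {y} ty μy≢μu with <-cmp (rank y) (rank t)
      ... | tri< y<t _ _ = contradiction
        (trans (cong μ (lower-neighbour-unique ty (Sym.symmetric E st) y<t s<t)) (Merged⇒μ≡μu s-merged)) μy≢μu
      ... | tri≈ _ y≈t _ = contradiction (trans (cong μ (rank-injective y≈t)) (Merged⇒μ≡μu t-merged)) μy≢μu
      ... | tri> _ _ t<y = t<y

      LowerLift : Fin n → Fin n → Set
      LowerLift a b = ∃[ y ] μ y ≡ b × SymClosure E (σ a) y × rank y < rank (σ a)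

      lower-lift : ∀ {a b} → SymClosure E/ a b → rank (σ b) < rank (σ a) → LowerLift a b
      lower-lift ab b<a with unpack ab
      ... | a≢b , x , y , refl , refl , xy = from (μ x ≟ᶠ μ u) (μ y ≟ᶠ μ u) b<a
        where
        from : Dec (μ x ≡ μ u) → Dec (μ y ≡ μ u) → rank (σ (μ y)) < rank (σ (μ x)) →
          LowerLift (μ x) (μ y)
        from (no μx≢μu) (no μy≢μu) y<x
          rewrite representative-μ s-merged {x} μx≢μu | representative-μ s-merged {y} μy≢μu =
          y , refl , xy , y<x
        from (no μx≢μu) (yes μy≡μu) y<x
          rewrite representative-μ s-merged {x} μx≢μu | representative-μu s-merged {y} μy≡μu
          with merged-cases (μ≡μu⇒Merged {y} μy≡μu)
        ... | inj₁ refl = y , refl , xy , y<x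
        ... | inj₂ refl = y , refl , xy , t-below-outside (Sym.symmetric E xy) μx≢μu
        from (yes μx≡μu) (no μy≢μu) y<x
          rewrite representative-μu s-merged {x} μx≡μu | representative-μ s-merged {y} μy≢μu
          with merged-cases (μ≡μu⇒Merged {x} μx≡μu)
        ... | inj₁ refl = y , refl , xy , y<x
        ... | inj₂ refl = contradiction (<-trans (t-below-outside xy μy≢μu) (<-trans y<x s<t)) (n≮n _)
        from (yes μx≡μu) (yes μy≡μu) _ = contradiction (trans μx≡μu (sym μy≡μu)) a≢b

      forestRanking-contract : ForestRanking E/
      forestRanking-contract = record
        { rank = rank ∘ σ
        ; rank-injective = λ {a} {b} r≡ → trans (sym (μ-representative s-merged a))
            (trans (cong μ (rank-injective r≡)) (μ-representative s-merged b))
        ; lower-neighbour-unique = λ {a} {b} {c} ab ac b<a c<a →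
            unique {a} (lower-lift ab b<a) (lower-lift ac c<a)
        }
        where
        unique : ∀ {a b c} → LowerLift a b → LowerLift a c → b ≡ c
        unique (y , refl , ay , y<a) (z , refl , az , z<a) = cong μ (lower-neighbour-unique ay az y<a z<a)

    forestRanking-contract : ForestRanking E/
    forestRanking-contract with <-cmp (rank u) (rank v)
    ... | tri< u<v _ _ = Ordered.forestRanking-contract u v (inj₁ refl) (inj₂ refl) u<v (fwd euv)
    ... | tri≈ _ u≈v _ = contradiction (sym (rank-injective u≈v)) v≢u
    ... | tri> _ _ v<u = Ordered.forestRanking-contract v u (inj₂ refl) (inj₁ refl) v<u (bwd euv)

-- Closure under butterfly minors

module _ {ℓ} (P : Digraph → Set ℓ)
  (step-closed : ∀ {G H} → Step G H → P G → P H)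
  (iso-closed : ∀ {H K} → H ≅ K → P K → P H)
  where

  butterflyMinor-closed : ∀ {H G} → ButterflyMinor H G → P G → P H
  butterflyMinor-closed (_ , G⇝K , H≅K) = iso-closed H≅K ∘ reduce G⇝K
    where
    reduce : ∀ {G K} → G ⇝ K → P G → P K
    reduce done         = λ pG → pG
    reduce (step s G⇝K) = reduce G⇝K ∘ step-closed s

private
  to-injective : ∀ {H K} (H≅K : H ≅ K) → Injective _≡_ _≡_ (Inverse.to (_≅_.bij H≅K))
  to-injective H≅K = Injection.injective (Inverse⇒Injection (_≅_.bij H≅K))

  to-hom : ∀ {H K} (H≅K : H ≅ K) → adj H =[ Inverse.to (_≅_.bij H≅K) ]⇒ adj K
  to-hom H≅K = _≅_.pres H≅K _ _

HereditaryStrongPairsOnCycles : Digraph → Set₁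
HereditaryStrongPairsOnCycles G = Hereditary StrongPairsOnCycles (adj G)

HasForestRanking : Digraph → Set
HasForestRanking G = ForestRanking (adj G)

hereditaryStrongPairsOnCycles-minor : ∀ {H G} → ButterflyMinor H G →
  HereditaryStrongPairsOnCycles G → HereditaryStrongPairsOnCycles H
hereditaryStrongPairsOnCycles-minor = butterflyMinor-closed HereditaryStrongPairsOnCycles
  (λ { (vdel n E v)               → hereditary-preimage (punchIn-injective v _ _) (λ e → e)
     ; (edel G u v)               → hereditary-preimage (λ e → e) proj₁
     ; (bcon n E u v v≢u contractible) → Contraction.hereditary-butterfly-contract E u v v≢u contractible })
  (λ H≅K → hereditary-preimage (to-injective H≅K) (to-hom H≅K))

forestRanking-minor : ∀ {H G} → ButterflyMinor H G → HasForestRanking G → HasForestRanking H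
forestRanking-minor = butterflyMinor-closed HasForestRanking
  (λ { (vdel n E v)              → forestRanking-preimage (punchIn-injective v _ _) (λ e → e)
     ; (edel G u v)              → forestRanking-preimage (λ e → e) proj₁
     ; (bcon n E u v v≢u (euv , _)) → Contraction.forestRanking-contract E u v v≢u euv })
  (λ H≅K → forestRanking-preimage (to-injective H≅K) (to-hom H≅K))

-- Squares and forests

module _ {E : Rel X 0ℓ} (fr : ForestRanking E) where
  open ForestRanking fr

  private
    no-peak : ∀ {x y z} → SymClosure E x y → SymClosure E x z → y ≢ z →
      rank y < rank x → rank z < rank x → ⊥
    no-peak xy xz y≢z y<x z<x = y≢z (lower-neighbour-unique xy xz y<x z<x)

    reversed : ∀ {a b} → SymClosure E a b → SymClosure E b a
    reversed = Sym.symmetric E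

    compare : ∀ {a b} → a ≢ b → rank a < rank b ⊎ rank b < rank a
    compare {a} {b} a≢b with <-cmp (rank a) (rank b)
    ... | tri< a<b _ _ = inj₁ a<b
    ... | tri≈ _ a≈b _ = contradiction (rank-injective a≈b) a≢b
    ... | tri> _ _ b<a = inj₂ b<a

  -- The vertex of largest rank on a square would have two lower neighbours.
  no-square : ∀ {a b c d} →
    SymClosure E a b → SymClosure E b c → SymClosure E c d → SymClosure E d a →
    a ≢ b → b ≢ c → c ≢ d → d ≢ a → a ≢ c → b ≢ d → ⊥
  no-square ab bc cd da a≢b b≢c c≢d d≢a a≢c b≢d with compare a≢b
  ... | inj₁ a<b with compare (b≢c ∘ sym)
  ...   | inj₁ c<b = no-peak (reversed ab) bc a≢c a<b c<b
  ...   | inj₂ b<c with compare (c≢d ∘ sym)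
  ...     | inj₁ d<c = no-peak (reversed bc) cd b≢d b<c d<c
  ...     | inj₂ c<d = no-peak (reversed cd) da (a≢c ∘ sym) c<d (<-trans a<b (<-trans b<c c<d))
  no-square ab bc cd da a≢b b≢c c≢d d≢a a≢c b≢d | inj₂ b<a with compare d≢a
  ...   | inj₁ d<a = no-peak ab (reversed da) b≢d b<a d<a
  ...   | inj₂ a<d with compare c≢d
  ...     | inj₁ c<d = no-peak da (reversed cd) a≢c a<d c<d
  ...     | inj₂ d<c = no-peak cd (reversed bc) (b≢d ∘ sym) d<c (<-trans b<a (<-trans a<d d<c))

forestRanking-CC : ∀ m → HasForestRanking (CC m)
forestRanking-CC m = record
  { rank = toℕ
  ; rank-injective = toℕ-injective
  ; lower-neighbour-unique = λ xy xz y<x z<x →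
      toℕ-injective (suc-injective (trans (predecessor-rank xy y<x) (sym (predecessor-rank xz z<x))))
  }
  where
  predecessor-rank : ∀ {x y} → SymClosure (adj (CC m)) x y → toℕ y < toℕ x → suc (toℕ y) ≡ toℕ x
  predecessor-rank (fwd (inj₁ y≡1+x)) y<x rewrite y≡1+x = contradiction (<⇒≤ y<x) 1+n≰n
  predecessor-rank (fwd (inj₂ x≡1+y)) _   = sym x≡1+y
  predecessor-rank (bwd (inj₁ x≡1+y)) _   = sym x≡1+y
  predecessor-rank (bwd (inj₂ y≡1+x)) y<x rewrite y≡1+x = contradiction (<⇒≤ y<x) 1+n≰n

¬forestRanking-L : ∀ {n} → 2 ≤ n → ¬ HasForestRanking (L n)
¬forestRanking-L {suc zero}    (s≤s ())
¬forestRanking-L {suc (suc k)} _ fr =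
  no-square fr ab bc cd da (λ ()) b≢c c≢d (λ ()) a≢c b≢d
  where
  c₀ : ℕ
  c₀ = k + suc (suc k)

  A B C D : Fin (suc (suc c₀))
  A = Fin.zero
  B = Fin.suc Fin.zero
  C = inject₁ (fromℕ c₀)
  D = fromℕ (suc c₀)

  C≡ : toℕ C ≡ c₀
  C≡ = trans (toℕ-inject₁ (fromℕ c₀)) (toℕ-fromℕ c₀)

  D≡ : toℕ D ≡ suc c₀
  D≡ = toℕ-fromℕ (suc c₀)

  k+1<c₀ : suc k < c₀
  k+1<c₀ = m≤n+m (suc (suc k)) k

  ≢-toℕ : ∀ {x y : Fin (suc (suc c₀))} → toℕ x ≢ toℕ y → x ≢ y
  ≢-toℕ ne = ne ∘ cong toℕ

  E = adj (L (suc (suc k)))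

  ab : SymClosure E A B
  ab = fwd (inj₁ (refl , λ ()))

  bc : SymClosure E B C
  bc = fwd (inj₂ (cong (suc ∘ suc) C≡))

  cd : SymClosure E C D
  cd = fwd (inj₁ (trans D≡ (cong suc (sym C≡)) ,
                  λ eq → <⇒≢ k+1<c₀ (sym (trans (sym C≡) (suc-injective eq)))))

  da : SymClosure E D A
  da = bwd (inj₂ (cong suc D≡))

  b≢c : B ≢ C
  b≢c = ≢-toℕ (λ eq → <⇒≢ (≤-<-trans (s≤s z≤n) k+1<c₀) (trans eq C≡))

  c≢d : C ≢ D
  c≢d = ≢-toℕ (λ eq → <⇒≢ (n<1+n c₀) (trans (sym C≡) (trans eq D≡)))

  a≢c : A ≢ C
  a≢c = ≢-toℕ (λ eq → <⇒≢ (≤-<-trans z≤n k+1<c₀) (trans eq C≡))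

  b≢d : B ≢ D
  b≢d = ≢-toℕ (λ eq → <⇒≢ (≤-<-trans z≤n k+1<c₀) (suc-injective (trans eq D≡)))

-- Walks and the ladder

module _ {F : Rel X 0ℓ} where

  vertices : ∀ {a b} → Star F a b → List X
  vertices {a} ε       = a ∷ []
  vertices {a} (_ ◅ w) = a ∷ vertices w

  source∈ : ∀ {a b} (w : Star F a b) → a ∈ vertices w
  source∈ ε       = here refl
  source∈ (_ ◅ _) = here refl

  target∈ : ∀ {a b} (w : Star F a b) → b ∈ vertices w
  target∈ ε       = here refl
  target∈ (_ ◅ w) = there (target∈ w)

  junction∈ : ∀ {a b c} (α : Star F a b) (β : Star F b c) → b ∈ vertices (α ◅◅ β)
  junction∈ ε       β = source∈ β
  junction∈ (_ ◅ α) β = there (junction∈ α β)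

  successor : ∀ {a b z} (w : Star F a b) → z ∈ vertices w →
    z ≡ b ⊎ ∃[ z′ ] F z z′ × z′ ∈ vertices w
  successor ε       (here refl) = inj₁ refl
  successor (f ◅ w) (here refl) = inj₂ (_ , f , there (source∈ w))
  successor (f ◅ w) (there z∈) with successor w z∈
  ... | inj₁ z≡b             = inj₁ z≡b
  ... | inj₂ (z′ , f′ , z′∈) = inj₂ (z′ , f′ , there z′∈)

  ◅◅-nonempty : ∀ {a b} (α : Star F a b) (β : Star F b a) → a ≢ b → α ◅◅ β ≢ ε
  ◅◅-nonempty ε       _ a≢b = contradiction refl a≢b
  ◅◅-nonempty (_ ◅ _) _ _   = λ ()

  successor-closed : ∀ {x z} (w : Star F x x) → w ≢ ε → z ∈ vertices w →
    ∃[ z′ ] F z z′ × z′ ∈ vertices w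
  successor-closed ε       w≢ε _  = contradiction refl w≢ε
  successor-closed (f ◅ w) _   z∈ with successor (f ◅ w) z∈
  ... | inj₁ refl = _ , f , there (source∈ w)
  ... | inj₂ next = next

  predecessor : ∀ {a b z} (w : Star F a b) → z ∈ vertices w →
    z ≡ a ⊎ ∃[ z′ ] F z′ z × z′ ∈ vertices w
  predecessor ε       (here refl) = inj₁ refl
  predecessor (_ ◅ _) (here refl) = inj₁ refl
  predecessor (f ◅ w) (there z∈) with predecessor w z∈
  ... | inj₁ refl            = inj₂ (_ , f , here refl)
  ... | inj₂ (z′ , f′ , z′∈) = inj₂ (z′ , f′ , there z′∈)

  last-edge : ∀ {a c b} (f : F a c) (w : Star F c b) → ∃[ z′ ] F z′ b × z′ ∈ vertices (f ◅ w)
  last-edge f ε        = _ , f , here refl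
  last-edge _ (f ◅ w) with z′ , f′ , z′∈ ← last-edge f w = z′ , f′ , there z′∈

  predecessor-closed : ∀ {x z} (w : Star F x x) → w ≢ ε → z ∈ vertices w →
    ∃[ z′ ] F z′ z × z′ ∈ vertices w
  predecessor-closed ε       w≢ε _  = contradiction refl w≢ε
  predecessor-closed (f ◅ w) _   z∈ with predecessor (f ◅ w) z∈
  ... | inj₁ refl = last-edge f w
  ... | inj₂ prev = prev

  module _ {P : X → Set} (P? : ∀ z → Dec (P z)) where

    Crossing : List X → Set
    Crossing zs = ∃[ c ] ∃[ d ] F c d × P c × ¬ P d × c ∈ zs × d ∈ zs

    private
      there-crossing : ∀ {z zs} → Crossing zs → Crossing (z ∷ zs)
      there-crossing (c , d , f , pc , ¬pd , c∈ , d∈) = c , d , f , pc , ¬pd , there c∈ , there d∈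

      crossing-from : ∀ {a b z} (w : Star F a b) → P a → z ∈ vertices w → ¬ P z →
        Crossing (vertices w)
      crossing-from ε       pa (here refl) ¬pz = contradiction pa ¬pz
      crossing-from (_ ◅ _) pa (here refl) ¬pz = contradiction pa ¬pz
      crossing-from (_◅_ {j = c} f w) pa (there z∈) ¬pz with P? c
      ... | no ¬pc = _ , c , f , pa , ¬pc , here refl , there (source∈ w)
      ... | yes pc = there-crossing (crossing-from w pc z∈ ¬pz)

      crossing-to : ∀ {a b z} (w : Star F a b) → z ∈ vertices w → P z → ¬ P b →
        Crossing (vertices w)
      crossing-to ε       (here refl) pz ¬pb = contradiction pz ¬pb
      crossing-to w@(_ ◅ _) (here refl) pz ¬pb = crossing-from w pz (target∈ w) ¬pb
      crossing-to (_ ◅ w) (there z∈)  pz ¬pb = there-crossing (crossing-to w z∈ pz ¬pb)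

    crossing-closed : ∀ {x z₁ z₂} (w : Star F x x) → z₁ ∈ vertices w → P z₁ →
      z₂ ∈ vertices w → ¬ P z₂ → Crossing (vertices w)
    crossing-closed {x} w z₁∈ pz₁ z₂∈ ¬pz₂ with P? x
    ... | yes px = crossing-from w px z₂∈ ¬pz₂
    ... | no ¬px = crossing-to w z₁∈ pz₁ ¬px

data Ladder : Rel (Bool × ℕ) 0ℓ where
  up    : ∀ k → Ladder (false , k) (false , suc k)
  down  : ∀ k → Ladder (true , suc k) (true , k)
  rung⁺ : ∀ k → Ladder (false , k) (true , k)
  rung⁻ : ∀ k → Ladder (true , k) (false , k)

height : Bool × ℕ → ℕ
height = proj₂

ascending : ℕ → ℕ → List (Bool × ℕ)
ascending k zero    = []
ascending k (suc j) = (false , suc k) ∷ ascending (suc k) j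

descending : ℕ → ℕ → List (Bool × ℕ)
descending k zero    = []
descending k (suc j) = (true , k + j) ∷ descending k j

-- The boundary of the part of the ladder between heights k and k + j.
rectangle : ℕ → ℕ → List (Bool × ℕ)
rectangle k j = (false , k) ∷ ascending k j ++ (true , k + j) ∷ descending k j

private
  k+j<k+1+j : ∀ k j → k + j < k + suc j
  k+j<k+1+j k j = +-monoʳ-< k (n<1+n j)

  ascending-bounds : ∀ k j → All (λ z → proj₁ z ≡ false × k < height z) (ascending k j)
  ascending-bounds k zero    = []
  ascending-bounds k (suc j) =
    (refl , n<1+n k) ∷ All.map (Product.map₂ (<-trans (n<1+n k))) (ascending-bounds (suc k) j)

  descending-bounds : ∀ k j → All (λ z → proj₁ z ≡ true × height z < k + j) (descending k j)
  descending-bounds k zero    = []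
  descending-bounds k (suc j) =
    (refl , k+j<k+1+j k j) ∷ All.map (Product.map₂ (λ r<k+j → <-trans r<k+j (k+j<k+1+j k j)))
                                     (descending-bounds k j)

  ascending-unique : ∀ k j → Unique (ascending k j)
  ascending-unique k zero    = []
  ascending-unique k (suc j) =
    All.map (λ (_ , k<r) eq → <-irrefl (cong height eq) k<r) (ascending-bounds (suc k) j) ∷
    ascending-unique (suc k) j

  descending-unique : ∀ k j → Unique (descending k j)
  descending-unique k zero    = []
  descending-unique k (suc j) =
    All.map (λ (_ , r<k+j) eq → <-irrefl (sym (cong height eq)) r<k+j) (descending-bounds k j) ∷
    descending-unique k j

rectangle-unique : ∀ k j → Unique (rectangle k j)
rectangle-unique k j =
  Allₚ.++⁺ (All.map (λ (_ , k<r) eq → <-irrefl (cong height eq) k<r) (ascending-bounds k j))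
           (false≢true ∘ cong proj₁ ∷ All.map (λ (side , _) eq → false≢true (trans (cong proj₁ eq) side))
                                              (descending-bounds k j)) ∷
  Unique.++⁺ (ascending-unique k j) (descending-unique k (suc j)) disjoint
  where
  false≢true : false ≢ true
  false≢true ()
  disjoint : Disjoint (ascending k j) ((true , k + j) ∷ descending k j)
  disjoint (z∈↑ , z∈↓) = false≢true (trans (sym (proj₁ (All.lookup (ascending-bounds k j) z∈↑)))
                                          (proj₁ (All.lookup (descending-bounds k (suc j)) z∈↓)))

private
  ∈-ascending : ∀ k j {r} → k < r → r ≤ k + j → (false , r) ∈ ascending k j
  ∈-ascending k zero    {r} k<r r≤k = contradiction (<-≤-trans k<r (subst (r ≤_) (+-identityʳ k) r≤k)) (n≮n _)
  ∈-ascending k (suc j) {r} k<r r≤k+j with m≤n⇒m<n∨m≡n k<r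
  ... | inj₂ refl = here refl
  ... | inj₁ k+1<r = there (∈-ascending (suc k) j k+1<r (subst (r ≤_) (+-suc k j) r≤k+j))

  ∈-descending : ∀ k j {r} → k ≤ r → r < k + j → (true , r) ∈ descending k j
  ∈-descending k zero    {r} k≤r r<k = contradiction (≤-<-trans k≤r (subst (r <_) (+-identityʳ k) r<k)) (n≮n _)
  ∈-descending k (suc j) {r} k≤r r<k+j with m≤n⇒m<n∨m≡n (s≤s⁻¹ (subst (r <_) (+-suc k j) r<k+j))
  ... | inj₂ refl = here refl
  ... | inj₁ r<k+j′ = there (∈-descending k j k≤r r<k+j′)

∈-rectangle : ∀ k j {s r} → k ≤ r → r ≤ k + j → (s , r) ∈ rectangle k j
∈-rectangle k j {false} k≤r r≤k+j with m≤n⇒m<n∨m≡n k≤r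
... | inj₂ refl = here refl
... | inj₁ k<r  = there (∈-++⁺ˡ (∈-ascending k j k<r r≤k+j))
∈-rectangle k j {true}  k≤r r≤k+j with m≤n⇒m<n∨m≡n r≤k+j
... | inj₂ refl  = there (∈-++⁺ʳ (ascending k j) (here refl))
... | inj₁ r<k+j = there (∈-++⁺ʳ (ascending k j) (there (∈-descending k j k≤r r<k+j)))

module _ {F : Rel (Bool × ℕ) 0ℓ} where

  private
    ascending-path : ∀ k j {ds b} →
      (∀ {i} → k ≤ i → i < k + j → F (false , i) (false , suc i)) →
      Path F (false , k + j) ds b → Path F (false , k) (ascending k j ++ ds) b
    ascending-path k zero    {ds} {b} ups p = subst (λ r → Path F (false , r) ds b) (+-identityʳ k) p
    ascending-path k (suc j) {ds} {b} ups p =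
      ups ≤-refl (m<m+n k z<s) ,
      ascending-path (suc k) j (λ {i} k<i i<k+j → ups (<⇒≤ k<i) (subst (i <_) (sym (+-suc k j)) i<k+j))
                     (subst (λ r → Path F (false , r) ds b) (+-suc k j) p)

    descending-path : ∀ k j {b} →
      (∀ {i} → k ≤ i → i < k + j → F (true , suc i) (true , i)) →
      F (true , k) b → Path F (true , k + j) (descending k j) b
    descending-path k zero    {b} downs f = subst (λ r → F (true , r) b) (sym (+-identityʳ k)) f
    descending-path k (suc j) {b} downs f =
      subst (λ r → F (true , r) (true , k + j)) (sym (+-suc k j)) (downs (m≤m+n k j) (k+j<k+1+j k j)) ,
      descending-path k j (λ k≤i i<k+j → downs k≤i (<-trans i<k+j (k+j<k+1+j k j))) f

  rectangle-cycle : ∀ k j →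
    (∀ {i} → k ≤ i → i < k + j → F (false , i) (false , suc i)) →
    (∀ {i} → k ≤ i → i < k + j → F (true , suc i) (true , i)) →
    F (false , k + j) (true , k + j) → F (true , k) (false , k) →
    Cycle F (rectangle k j)
  rectangle-cycle k j ups downs top bottom =
    rectangle-unique k j , ascending-path k j ups (top , descending-path k j downs bottom)

  rectangle-between : ∀ lo hi → lo ≤ hi →
    (∀ {i} → lo ≤ i → i < hi → F (false , i) (false , suc i)) →
    (∀ {i} → lo ≤ i → i < hi → F (true , suc i) (true , i)) →
    F (false , hi) (true , hi) → F (true , lo) (false , lo) →
    ∃[ D ] Cycle F D × (∀ {s r} → lo ≤ r → r ≤ hi → (s , r) ∈ D)
  rectangle-between lo hi lo≤hi ups downs top bottom with j , refl ← m≤n⇒∃[o]m+o≡n lo≤hi =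
    rectangle lo j , rectangle-cycle lo j ups downs top bottom , ∈-rectangle lo j


module _ {F : Rel (Bool × ℕ) 0ℓ} (F⇒Ladder : F ⇒ Ladder) where

  private
    up-crossing : ∀ {c d i} → F c d → height c ≤ i → i < height d → F (false , i) (false , suc i)
    up-crossing f c≤i i<d with F⇒Ladder f
    ... | up _ with refl ← ≤-antisym c≤i (s≤s⁻¹ i<d) = f
    ... | down _  = contradiction (<-trans c≤i i<d) (n≮n _)
    ... | rung⁺ _ = contradiction (≤-<-trans c≤i i<d) (n≮n _)
    ... | rung⁻ _ = contradiction (≤-<-trans c≤i i<d) (n≮n _)

    down-crossing : ∀ {c d i} → F c d → i < height c → height d ≤ i → F (true , suc i) (true , i)
    down-crossing f i<c d≤i with F⇒Ladder f
    ... | down _ with refl ← ≤-antisym d≤i (s≤s⁻¹ i<c) = f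
    ... | up _    = contradiction (<-trans i<c d≤i) (n≮n _)
    ... | rung⁺ _ = contradiction (<-≤-trans i<c d≤i) (n≮n _)
    ... | rung⁻ _ = contradiction (<-≤-trans i<c d≤i) (n≮n _)

    top-rung : ∀ {h d} → F (false , h) d → height d ≤ h → F (false , h) (true , h)
    top-rung f d≤h with F⇒Ladder f
    ... | up _    = contradiction d≤h 1+n≰n
    ... | rung⁺ _ = f

    bottom-rung : ∀ {l d} → F (true , l) d → l ≤ height d → F (true , l) (false , l)
    bottom-rung f l≤d with F⇒Ladder f
    ... | down _  = contradiction l≤d 1+n≰n
    ... | rung⁻ _ = f

    into-top : ∀ {h c} → F c (true , h) → height c ≤ h → c ≡ (false , h)
    into-top f c≤h with F⇒Ladder f
    ... | down _  = contradiction c≤h 1+n≰n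
    ... | rung⁺ _ = refl

    into-bottom : ∀ {l c} → F c (false , l) → l ≤ height c → c ≡ (true , l)
    into-bottom f l≤c with F⇒Ladder f
    ... | up _    = contradiction l≤c 1+n≰n
    ... | rung⁻ _ = refl

    -- Between the lowest and the highest height of the closed walk α β, every level is
    -- crossed upwards and downwards, which only rail edges can do; together with the rungs
    -- at the two extreme heights they form a rectangle, a cycle through x and y.
    module EnclosingRectangle {x y} (x≢y : x ≢ y) (α : Star F x y) (β : Star F y x) where

      W : Star F x x
      W = α ◅◅ β

      S : List (Bool × ℕ)
      S = vertices W

      W≢ε : W ≢ ε
      W≢ε = ◅◅-nonempty α β x≢y

      lowest highest : Bool × ℕ
      lowest  = argmin height x S
      highest = argmax height x S

      lo hi : ℕ
      lo = height lowest
      hi = height highest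

      lowest∈ : lowest ∈ S
      lowest∈ = argmin-all height (source∈ W) (All.tabulate (λ z∈ → z∈))

      highest∈ : highest ∈ S
      highest∈ = argmax-all height (source∈ W) (All.tabulate (λ z∈ → z∈))

      lo≤ : ∀ {z} → z ∈ S → lo ≤ height z
      lo≤ = All.lookup (f[argmin]≤f[xs] {f = height} x S)

      ≤hi : ∀ {z} → z ∈ S → height z ≤ hi
      ≤hi = All.lookup (f[xs]≤f[argmax] {f = height} x S)

      ups : ∀ {i} → lo ≤ i → i < hi → F (false , i) (false , suc i)
      ups {i} lo≤i i<hi
        with _ , _ , f , c≤i , d≰i , _ ←
             crossing-closed (λ z → height z ≤? i) W lowest∈ lo≤i highest∈ (<⇒≱ i<hi) =
        up-crossing f c≤i (≰⇒> d≰i)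

      downs : ∀ {i} → lo ≤ i → i < hi → F (true , suc i) (true , i)
      downs {i} lo≤i i<hi
        with _ , _ , f , i<c , d≮i , _ ←
             crossing-closed (λ z → i <? height z) W highest∈ i<hi lowest∈ (≤⇒≯ lo≤i) =
        down-crossing f i<c (≮⇒≥ d≮i)

      top-left∈ : (false , hi) ∈ S
      top-left∈ = on-side (proj₁ highest) highest∈
        where
        on-side : ∀ s → (s , hi) ∈ S → (false , hi) ∈ S
        on-side false top∈ = top∈
        on-side true  top∈ with z′ , f , z′∈ ← predecessor-closed W W≢ε top∈ =
          subst (_∈ S) (into-top f (≤hi z′∈)) z′∈

      bottom-right∈ : (true , lo) ∈ S
      bottom-right∈ = on-side (proj₁ lowest) lowest∈
        where
        on-side : ∀ s → (s , lo) ∈ S → (true , lo) ∈ S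
        on-side true  bottom∈ = bottom∈
        on-side false bottom∈ with z′ , f , z′∈ ← predecessor-closed W W≢ε bottom∈ =
          subst (_∈ S) (into-bottom f (lo≤ z′∈)) z′∈

      top : F (false , hi) (true , hi)
      top with _ , f , z′∈ ← successor-closed W W≢ε top-left∈ = top-rung f (≤hi z′∈)

      bottom : F (true , lo) (false , lo)
      bottom with _ , f , z′∈ ← successor-closed W W≢ε bottom-right∈ = bottom-rung f (lo≤ z′∈)

      x∈ : x ∈ S
      x∈ = source∈ W

      y∈ : y ∈ S
      y∈ = junction∈ α β

      cycle-through : ∃[ D ] Cycle F D × x ∈ D × y ∈ D
      cycle-through with D , cycle , ∈D ← rectangle-between lo hi (lo≤ highest∈) ups downs top bottom =
        D , cycle , ∈D (lo≤ x∈) (≤hi x∈) , ∈D (lo≤ y∈) (≤hi y∈)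

  strongPairsOnCycles-ladder : StrongPairsOnCycles F
  strongPairsOnCycles-ladder = EnclosingRectangle.cycle-through

hereditary-ladder : Hereditary StrongPairsOnCycles Ladder
hereditary-ladder _ = strongPairsOnCycles-ladder

-- Vertex t of L n sits at height t on the false rail if t < n (it is p_{t+1}),
-- and otherwise at height k on the true rail, where t + k + 1 = 2n (it is q_{t+1-n}).
module LadderEmbedding (n : ℕ) where

  Position : ℕ → Bool × ℕ → Set
  Position t z = (t < n × z ≡ (false , t)) ⊎ (n ≤ t × ∃[ k ] z ≡ (true , k) × suc (t + k) ≡ n + n)

  position : ∀ {t} → t < n + n → ∃ (Position t)
  position {t} t<2n with t <? n
  ... | yes t<n = _ , inj₁ (t<n , refl)
  ... | no  t≮n = _ , inj₂ (≮⇒≥ t≮n , _ , refl , m+[n∸m]≡n t<2n)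

  position-injective : ∀ {s t z} → Position s z → Position t z → s ≡ t
  position-injective (inj₁ (_ , refl)) (inj₁ (_ , refl)) = refl
  position-injective (inj₁ (_ , refl)) (inj₂ (_ , _ , () , _))
  position-injective (inj₂ (_ , _ , refl , _)) (inj₁ (_ , ()))
  position-injective (inj₂ (_ , k , refl , s+k)) (inj₂ (_ , _ , refl , t+k)) =
    +-cancelʳ-≡ k _ _ (suc-injective (trans s+k (sym t+k)))

  position-adjacent : ∀ {a b z z′} → Position a z → Position b z′ →
    (b ≡ suc a × suc a ≢ n) ⊎ (suc (a + b) ≡ n + n) → Ladder z z′
  position-adjacent (inj₁ (_ , refl)) (inj₁ (_ , refl)) (inj₁ (refl , _)) = up _
  position-adjacent (inj₁ (a<n , _)) (inj₂ (n≤b , _)) (inj₁ (refl , 1+a≢n)) =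
    contradiction (≤-antisym a<n n≤b) 1+a≢n
  position-adjacent (inj₂ (n≤a , _)) (inj₁ (b<n , _)) (inj₁ (refl , _)) =
    contradiction (<-trans (s≤s n≤a) b<n) (n≮n _)
  position-adjacent {a} (inj₂ (_ , ka , refl , a+ka)) (inj₂ (_ , kb , refl , b+kb)) (inj₁ (refl , _))
    with refl ← +-cancelˡ-≡ a ka (suc kb)
                  (suc-injective (trans a+ka (trans (sym b+kb) (cong suc (sym (+-suc a kb)))))) =
    down kb
  position-adjacent {a} {b} (inj₁ (a<n , _)) (inj₁ (b<n , _)) (inj₂ a+b) =
    contradiction (subst₂ _≤_ (cong suc (+-suc a b)) (sym a+b) (+-mono-≤ a<n b<n)) 1+n≰n
  position-adjacent {a} (inj₁ (_ , refl)) (inj₂ (_ , kb , refl , b+kb)) (inj₂ a+b)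
    with refl ← +-cancelˡ-≡ _ kb a (suc-injective (trans b+kb (trans (sym a+b) (cong suc (+-comm a _))))) =
    rung⁺ a
  position-adjacent {a} (inj₂ (_ , ka , refl , a+ka)) (inj₁ (_ , refl)) (inj₂ a+b)
    with refl ← +-cancelˡ-≡ a ka _ (suc-injective (trans a+ka (sym a+b))) =
    rung⁻ ka
  position-adjacent {a} {b} (inj₂ (n≤a , _)) (inj₂ (n≤b , _)) (inj₂ a+b) =
    contradiction (subst (_≤ a + b) (sym a+b) (+-mono-≤ n≤a n≤b)) 1+n≰n

  embed : Fin (n + n) → Bool × ℕ
  embed a = proj₁ (position (toℕ<n a))

  private
    embed-position : ∀ a → Position (toℕ a) (embed a)
    embed-position a = proj₂ (position (toℕ<n a))

  embed-injective : Injective _≡_ _≡_ embed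
  embed-injective {a} {b} ea≡eb =
    toℕ-injective (position-injective (embed-position a) (subst (Position _) (sym ea≡eb) (embed-position b)))

  embed-adjacent : adj (L n) =[ embed ]⇒ Ladder
  embed-adjacent {a} {b} = position-adjacent (embed-position a) (embed-position b)

hereditary-L : ∀ n → HereditaryStrongPairsOnCycles (L n)
hereditary-L n = hereditary-preimage embed-injective embed-adjacent hereditary-ladder
  where open LadderEmbedding n

-- Cycles in CC m

even : ℕ → Bool
even zero    = true
even (suc n) = not (even n)

even-flips : ∀ {a b} → b ≡ suc a ⊎ a ≡ suc b → even b ≡ not (even a)
even-flips         (inj₁ refl) = refl
even-flips {b = b} (inj₂ refl) = sym (not-involutive (even b))

private
  E₃ : Rel (Fin 3) 0ℓ
  E₃ = adj (CC 3)

  even-flips² : ∀ {a b c} → E₃ a b → E₃ b c → even (toℕ c) ≡ even (toℕ a)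
  even-flips² ab bc = trans (even-flips bc) (trans (cong not (even-flips ab)) (not-involutive _))

  odd-unique : ∀ {x y : Fin 3} → even (toℕ x) ≡ false → even (toℕ y) ≡ false → x ≡ y
  odd-unique {Fin.suc Fin.zero} {Fin.suc Fin.zero} _ _ = refl
  odd-unique {Fin.zero}                     ()
  odd-unique {Fin.suc (Fin.suc Fin.zero)}   ()
  odd-unique {y = Fin.zero}                   _ ()
  odd-unique {y = Fin.suc (Fin.suc Fin.zero)} _ ()

  -- A cycle through 0 and 2 would have to pass twice through 1, the only vertex of odd index.
  no-cycle-through-ends : ∀ D → Cycle E₃ D → Fin.zero ∈ D → Fin.suc (Fin.suc Fin.zero) ∈ D → ⊥
  no-cycle-through-ends (_ ∷ []) (_ , aa) _ _ = not-¬ refl (even-flips aa)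
  no-cycle-through-ends (_ ∷ _ ∷ []) (_ , ab , _) (here refl) (there (here refl)) =
    contradiction (even-flips ab) λ ()
  no-cycle-through-ends (_ ∷ _ ∷ []) (_ , _ , ba) (there (here refl)) (here refl) =
    contradiction (even-flips ba) λ ()
  no-cycle-through-ends (_ ∷ _ ∷ []) _ (here refl)        (here ())
  no-cycle-through-ends (_ ∷ _ ∷ []) _ (there (here refl)) (there (here ()))
  no-cycle-through-ends (_ ∷ _ ∷ []) _ (there (there ()))  _
  no-cycle-through-ends (_ ∷ _ ∷ []) _ _                   (there (there ()))
  no-cycle-through-ends (_ ∷ _ ∷ _ ∷ []) (_ , ab , bc , ca) _ _ =
    not-¬ refl (trans (even-flips ca) (cong not (even-flips² ab bc)))
  no-cycle-through-ends (a ∷ _ ∷ _ ∷ _ ∷ _) ((_ ∷ a≢c ∷ _) ∷ (_ ∷ b≢d ∷ _) ∷ _ , ab , bc , cd , _) _ _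
    with even (toℕ a) in a-even
  ... | false = a≢c (odd-unique a-even (trans (even-flips² ab bc) a-even))
  ... | true  = b≢d (odd-unique b-odd (trans (even-flips² bc cd) b-odd))
    where b-odd = trans (even-flips ab) (cong not a-even)

¬hereditary-CC₃ : ¬ HereditaryStrongPairsOnCycles (CC 3)
¬hereditary-CC₃ spc
  with D , cycle , 0∈ , 2∈ ← spc E₃ (λ e → e) (λ ()) (inj₁ refl ◅ inj₁ refl ◅ ε) (inj₂ refl ◅ inj₂ refl ◅ ε) =
  no-cycle-through-ends D cycle 0∈ 2∈

¬hereditary-CC : ∀ {m} → 3 ≤ m → ¬ HereditaryStrongPairsOnCycles (CC m)
¬hereditary-CC 3≤m = ¬hereditary-CC₃ ∘ hereditary-preimage (inject≤-injective 3≤m 3≤m _ _) inject≤-adjacent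
  where
  inject≤-adjacent : adj (CC 3) =[ (λ i → inject≤ i 3≤m) ]⇒ adj (CC _)
  inject≤-adjacent {a} {b} e rewrite toℕ-inject≤ a 3≤m | toℕ-inject≤ b 3≤m = e

lemma8p2 : (n m : ℕ) → 2 ≤ n → 3 ≤ m →
    ¬ ButterflyMinor (L n) (CC m) × ¬ ButterflyMinor (CC m) (L n)
lemma8p2 n m 2≤n 3≤m =
  (λ L≼CC → ¬forestRanking-L 2≤n (forestRanking-minor L≼CC (forestRanking-CC m))) ,
  (λ CC≼L → ¬hereditary-CC 3≤m (hereditaryStrongPairsOnCycles-minor CC≼L (hereditary-L n)))
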